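{- Let $t(n)$ denote the number of maximal independent sets of the triangular cactus $T(n)$. Then $t(1)=3$, $t(2)=5$, and $t(n)=t(n-1)+t(n-2)$ for all $n\ge 3$.
   Context: For $n\ge 1$, the triangular cactus $T(n)$ is the graph formed by a chain of $n$ triangles $B_1,\dots,B_n$, where for each $1\le i\le n-1$ the consecutive triangles $B_i$ and $B_{i+1}$ share exactly one vertex, non-consecutive triangles share no vertex, and every vertex lies in at most two triangles. An independent set is maximal if no further vertex can be added while keeping it independent. -}

module Defs where

open import Data.Nat using (ℕ; zero; suc; _+_; _*_; _≡ᵇ_; _<ᵇ_)
open import Data.Bool using (Bool; true; false; _∧_; _∨_; not; if_then_else_)
open import Data.Fin using (Fin; toℕ)
open import Data.Vec using (Vec; []; _∷_; lookup; _[_]≔_)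
open import Data.List using (List; []; _∷_; map; _++_; allFin)
open import Data.Bool.ListAction using (all)
open import Data.Fin.Subset using (Subset)
open import Relation.Nullary.Decidable using (Dec; yes; no)
open import Relation.Binary.PropositionalEquality using (_≡_)

-- Triangle B_{i+1} (i = 0, ..., n-1) has vertex set {2i, 2i+1, 2i+2}.
-- Consecutive triangles share exactly the vertex 2i+2, non-consecutive
-- triangles are disjoint, and each vertex lies in at most two triangles;
-- this is the (unique up to isomorphism) triangular cactus chain T(n).

inTri : ℕ → ℕ → Bool
inTri i k = (k ≡ᵇ 2 * i) ∨ (k ≡ᵇ 2 * i + 1) ∨ (k ≡ᵇ 2 * i + 2)

sharesTri : ℕ → ℕ → ℕ → Bool
sharesTri zero    x y = false
sharesTri (suc i) x y = (inTri i x ∧ inTri i y) ∨ sharesTri i x y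

Vertex : ℕ → Set
Vertex n = Fin (suc (2 * n))

adj : (n : ℕ) → Vertex n → Vertex n → Bool
adj n x y = not (toℕ x ≡ᵇ toℕ y) ∧ sharesTri n (toℕ x) (toℕ y)

independent : (n : ℕ) → Subset (suc (2 * n)) → Bool
independent n S =
  all (λ x → all (λ y → not (lookup S x ∧ lookup S y ∧ adj n x y)) (allFin _)) (allFin _)

maximalIndependent : (n : ℕ) → Subset (suc (2 * n)) → Bool
maximalIndependent n S =
  independent n S ∧
  all (λ v → lookup S v ∨ not (independent n (S [ v ]≔ true))) (allFin _)

allSubsets : (m : ℕ) → List (Subset m)
allSubsets zero    = [] ∷ []
allSubsets (suc m) = map (false ∷_) (allSubsets m) ++ map (true ∷_) (allSubsets m)

countTrue : {A : Set} → (A → Bool) → List A → ℕ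
countTrue p []       = 0
countTrue p (x ∷ xs) = if p x then suc (countTrue p xs) else countTrue p xs

t : ℕ → ℕ
t n = countTrue (maximalIndependent n) (allSubsets (suc (2 * n)))

-- A vertex set S of T(n) (n ≥ 1) is maximal independent exactly when it meets every
-- triangle in exactly one vertex: two vertices of a triangle are adjacent, every
-- vertex lies in a triangle, and if a triangle is unmarked then its middle vertex,
-- whose only neighbours are the other two corners of that triangle, can be added.
-- Reading the vertices 0, …, 2n as a word over Bool, S is therefore a word in which
-- every window (2i, 2i+1, 2i+2) contains exactly one true. Counting such words by the
-- first letter a of the current window gives w_false(m+2) = w_false(m) + w_true(m)
-- and w_true(m+2) = w_false(m), and t(n) = w_false(2n+2) is then a Fibonacci sequence.

module Submission where

open import Defs
open import Data.Bool using (Bool; true; false; T; T?; not; _∧_; _∨_)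
open import Data.Bool.ListAction using (all)
open import Data.Bool.Properties using (T-∧; T-∨)
open import Data.Empty using (⊥; ⊥-elim)
open import Data.Fin as Fin using (Fin; toℕ; fromℕ<)
open import Data.Fin.Properties using (toℕ-fromℕ<; toℕ<n)
open import Data.Fin.Subset using (Subset)
open import Data.List using (List; []; _∷_; map; _++_; length; allFin)
open import Data.List.Membership.Propositional.Properties using (∈-allFin)
import Data.List.Relation.Unary.All as All
open import Data.List.Relation.Unary.All.Properties using (all⁺; all⁻)
open import Data.Nat
  using (ℕ; zero; suc; _+_; _*_; _≡ᵇ_; _<_; _≥_; _∸_; z≤n; s≤s; z<s)
open import Data.Nat.Properties
  using (+-comm; +-identityʳ; *-suc; suc-injective; ≡ᵇ⇒≡; ≡⇒≡ᵇ; n<1+n; m<n⇒m<1+n;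
         m<1+n⇒m<n∨m≡n; 1+n≢n; m≢1+n+m; even≢odd)
open import Data.Product using (_×_; _,_; proj₁; proj₂; ∃-syntax)
open import Data.Sum using (_⊎_; inj₁; inj₂)
open import Data.Vec using (Vec; _∷_; lookup; toList; _[_]≔_)
open import Data.Vec.Properties using (length-toList)
open import Function using (_∘_; _⇔_; mk⇔; Equivalence)
open import Relation.Binary.PropositionalEquality
open import Relation.Nullary using (¬_)
open import Relation.Nullary.Decidable using (decidable-stable)

open Equivalence using (to; from)

countTrue-++ : {A : Set} (p : A → Bool) (xs ys : List A) →
  countTrue p (xs ++ ys) ≡ countTrue p xs + countTrue p ys
countTrue-++ p []       ys = refl
countTrue-++ p (x ∷ xs) ys with p x
... | true  = cong suc (countTrue-++ p xs ys)
... | false = countTrue-++ p xs ys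

countTrue-map : {A B : Set} (p : B → Bool) (f : A → B) (xs : List A) →
  countTrue p (map f xs) ≡ countTrue (p ∘ f) xs
countTrue-map p f []       = refl
countTrue-map p f (x ∷ xs) with p (f x)
... | true  = cong suc (countTrue-map p f xs)
... | false = countTrue-map p f xs

countTrue-cong : {A : Set} {p q : A → Bool} → (∀ x → p x ≡ q x) → (xs : List A) →
  countTrue p xs ≡ countTrue q xs
countTrue-cong         p≗q []       = refl
countTrue-cong {q = q} p≗q (x ∷ xs) rewrite p≗q x with q x
... | true  = cong suc (countTrue-cong p≗q xs)
... | false = countTrue-cong p≗q xs

countTrue-false : {A : Set} (xs : List A) → countTrue (λ _ → false) xs ≡ 0
countTrue-false []       = refl
countTrue-false (x ∷ xs) = countTrue-false xs

countTrue-allSubsets-suc : ∀ m (p : Subset (suc m) → Bool) →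
  countTrue p (allSubsets (suc m)) ≡
  countTrue (p ∘ (false ∷_)) (allSubsets m) + countTrue (p ∘ (true ∷_)) (allSubsets m)
countTrue-allSubsets-suc m p =
  trans (countTrue-++ p (map (false ∷_) (allSubsets m)) (map (true ∷_) (allSubsets m)))
        (cong₂ _+_ (countTrue-map p (false ∷_) (allSubsets m))
                   (countTrue-map p (true ∷_) (allSubsets m)))

countTrue-allSubsets-2+ : ∀ m (p : Subset (2 + m) → Bool) →
  let c : Bool → Bool → ℕ
      c x y = countTrue (λ v → p (x ∷ y ∷ v)) (allSubsets m)
  in countTrue p (allSubsets (2 + m)) ≡
     (c false false + c false true) + (c true false + c true true)
countTrue-allSubsets-2+ m p =
  trans (countTrue-allSubsets-suc (suc m) p)
        (cong₂ _+_ (countTrue-allSubsets-suc m _) (countTrue-allSubsets-suc m _))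

exactlyOne : Bool → Bool → Bool → Bool
exactlyOne true  b     c = not (b ∨ c)
exactlyOne false true  c = not c
exactlyOne false false c = c

oneInEachWindow : Bool → List Bool → Bool
oneInEachWindow a []          = true
oneInEachWindow a (b ∷ [])    = false
oneInEachWindow a (b ∷ c ∷ w) = exactlyOne a b c ∧ oneInEachWindow c w

windowWords : Bool → ℕ → ℕ
windowWords a m = countTrue (oneInEachWindow a ∘ toList) (allSubsets m)

windowWords-false : ∀ m → windowWords false (2 + m) ≡ windowWords false m + windowWords true m
windowWords-false m = begin
  windowWords false (2 + m)
    ≡⟨ countTrue-allSubsets-2+ m (oneInEachWindow false ∘ toList) ⟩
  (none + windowWords true m) + (windowWords false m + none)
    ≡⟨ cong₂ (λ x y → (x + windowWords true m) + (windowWords false m + y))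
             none≡0 none≡0 ⟩
  windowWords true m + (windowWords false m + 0)
    ≡⟨ cong (windowWords true m +_) (+-identityʳ _) ⟩
  windowWords true m + windowWords false m
    ≡⟨ +-comm (windowWords true m) _ ⟩
  windowWords false m + windowWords true m ∎
  where
  open ≡-Reasoning
  none = countTrue (λ _ → false) (allSubsets m)
  none≡0 = countTrue-false (allSubsets m)

windowWords-true : ∀ m → windowWords true (2 + m) ≡ windowWords false m
windowWords-true m = begin
  windowWords true (2 + m)
    ≡⟨ countTrue-allSubsets-2+ m (oneInEachWindow true ∘ toList) ⟩
  (windowWords false m + none) + (none + none)
    ≡⟨ cong₂ (λ x y → (windowWords false m + x) + (y + y)) none≡0 none≡0 ⟩
  windowWords false m + 0 + 0
    ≡⟨ trans (+-identityʳ _) (+-identityʳ _) ⟩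
  windowWords false m ∎
  where
  open ≡-Reasoning
  none = countTrue (λ _ → false) (allSubsets m)
  none≡0 = countTrue-false (allSubsets m)

windowWords-fibonacci : ∀ m →
  windowWords false (2 * (2 + m)) ≡ windowWords false (2 * (1 + m)) + windowWords false (2 * m)
windowWords-fibonacci m = begin
  windowWords false (2 * (2 + m))
    ≡⟨ cong (windowWords false) (*-suc 2 (1 + m)) ⟩
  windowWords false (2 + 2 * (1 + m))
    ≡⟨ windowWords-false (2 * (1 + m)) ⟩
  windowWords false (2 * (1 + m)) + windowWords true (2 * (1 + m))
    ≡⟨ cong (λ l → windowWords false (2 * (1 + m)) + windowWords true l) (*-suc 2 m) ⟩
  windowWords false (2 * (1 + m)) + windowWords true (2 + 2 * m)
    ≡⟨ cong (windowWords false (2 * (1 + m)) +_) (windowWords-true (2 * m)) ⟩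
  windowWords false (2 * (1 + m)) + windowWords false (2 * m) ∎
  where open ≡-Reasoning

double : ℕ → ℕ
double zero    = zero
double (suc n) = suc (suc (double n))

2*≡double : ∀ n → 2 * n ≡ double n
2*≡double zero    = refl
2*≡double (suc n) = trans (*-suc 2 n) (cong (suc ∘ suc) (2*≡double n))

double-injective : ∀ {i j} → double i ≡ double j → i ≡ j
double-injective {zero}  {zero}  _ = refl
double-injective {suc i} {suc j} e = cong suc (double-injective (suc-injective (suc-injective e)))

double≢1+double : ∀ i j → double i ≢ suc (double j)
double≢1+double i j e =
  even≢odd i j (trans (2*≡double i) (trans e (cong suc (sym (2*≡double j)))))

1+double<1+double : ∀ {i n} → i < n → suc (double i) < suc (double n)
1+double<1+double {zero}  {suc n} _           = s≤s (s≤s z≤n)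
1+double<1+double {suc i} {suc n} (s≤s i<n) = s≤s (s≤s (1+double<1+double i<n))

InTriangle : ℕ → ℕ → Set
InTriangle j p = p ≡ double j ⊎ p ≡ suc (double j) ⊎ p ≡ suc (suc (double j))

InTriangle-suc : ∀ {j p} → InTriangle j p → InTriangle (suc j) (suc (suc p))
InTriangle-suc (inj₁ refl)        = inj₁ refl
InTriangle-suc (inj₂ (inj₁ refl)) = inj₂ (inj₁ refl)
InTriangle-suc (inj₂ (inj₂ refl)) = inj₂ (inj₂ refl)

InTriangle-middle : ∀ {i j} → InTriangle j (suc (double i)) → j ≡ i
InTriangle-middle {i} {j} (inj₁ e)        = ⊥-elim (double≢1+double j i (sym e))
InTriangle-middle {i} {j} (inj₂ (inj₁ e)) = sym (double-injective (suc-injective e))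
InTriangle-middle {i} {j} (inj₂ (inj₂ e)) = ⊥-elim (double≢1+double i j (suc-injective e))

inSomeTriangle : ∀ k v → v < suc (double (suc k)) → ∃[ j ] (j < suc k × InTriangle j v)
inSomeTriangle k       0             _                 = 0 , z<s , inj₁ refl
inSomeTriangle k       1             _                 = 0 , z<s , inj₂ (inj₁ refl)
inSomeTriangle zero    2             _                 = 0 , z<s , inj₂ (inj₂ refl)
inSomeTriangle zero    (suc (suc (suc v))) (s≤s (s≤s (s≤s ())))
inSomeTriangle (suc k) (suc (suc v)) (s≤s (s≤s v<))  =
  let j , j<k , v∈j = inSomeTriangle k v v< in suc j , s≤s j<k , InTriangle-suc v∈j

Adjacent : ℕ → ℕ → ℕ → Set
Adjacent n p q = p ≢ q × ∃[ j ] (j < n × InTriangle j p × InTriangle j q)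

Adjacent-middle : ∀ {n i q} → Adjacent n (suc (double i)) q →
  q ≡ double i ⊎ q ≡ suc (suc (double i))
Adjacent-middle (v≢q , j , _ , v∈j , q∈j) with InTriangle-middle v∈j | q∈j
... | refl | inj₁ e        = inj₁ e
... | refl | inj₂ (inj₁ e) = ⊥-elim (v≢q (sym e))
... | refl | inj₂ (inj₂ e) = inj₂ e

T-≡ᵇ : ∀ p {m n} → m ≡ n → T (p ≡ᵇ m) ⇔ p ≡ n
T-≡ᵇ p {m} refl = mk⇔ (≡ᵇ⇒≡ p m) (≡⇒≡ᵇ p m)

T-not-≡ᵇ : ∀ m n → T (not (m ≡ᵇ n)) ⇔ m ≢ n
T-not-≡ᵇ m n with m ≡ᵇ n in eq
... | true  = mk⇔ (λ ()) (λ m≢n → m≢n (≡ᵇ⇒≡ m n (subst T (sym eq) _)))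
... | false = mk⇔ (λ _ m≡n → subst T eq (≡⇒≡ᵇ m n m≡n)) (λ _ → _)

T-not : ∀ b → T (not b) ⇔ (¬ T b)
T-not true  = mk⇔ (λ ()) (λ ¬t → ¬t _)
T-not false = mk⇔ (λ _ ()) (λ _ → _)

T-∨-not : ∀ a b → T (a ∨ not b) ⇔ (T b → T a)
T-∨-not true  _     = mk⇔ (λ _ _ → _) (λ _ → _)
T-∨-not false true  = mk⇔ (λ ()) (λ b⇒a → b⇒a _)
T-∨-not false false = mk⇔ (λ _ ()) (λ _ → _)

T-injective : ∀ {a b} → T a ⇔ T b → a ≡ b
T-injective {true}  {true}  _ = refl
T-injective {true}  {false} e = ⊥-elim (to e _)
T-injective {false} {true}  e = ⊥-elim (from e _)
T-injective {false} {false} _ = refl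

T-all-allFin : ∀ {m} (p : Fin m → Bool) → T (all p (allFin m)) ⇔ (∀ x → T (p x))
T-all-allFin p = mk⇔
  (λ h x → All.lookup (all⁺ p _ h) (∈-allFin x))
  (λ h → all⁻ p {allFin _} (All.tabulate (λ {x} _ → h x)))

T-inTri : ∀ j p → T (inTri j p) ⇔ InTriangle j p
T-inTri j p = mk⇔ into (λ p∈j → from T-∨ (outof p∈j))
  where
  2j≡ = 2*≡double j
  2j+1≡ = trans (+-comm (2 * j) 1) (cong suc 2j≡)
  2j+2≡ = trans (+-comm (2 * j) 2) (cong (suc ∘ suc) 2j≡)
  into : T (inTri j p) → InTriangle j p
  into h with to (T-∨ {p ≡ᵇ 2 * j}) h
  ... | inj₁ h₀ = inj₁ (to (T-≡ᵇ p 2j≡) h₀)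
  ... | inj₂ h₁₂ with to (T-∨ {p ≡ᵇ 2 * j + 1}) h₁₂
  ...   | inj₁ h₁ = inj₂ (inj₁ (to (T-≡ᵇ p 2j+1≡) h₁))
  ...   | inj₂ h₂ = inj₂ (inj₂ (to (T-≡ᵇ p 2j+2≡) h₂))
  outof : InTriangle j p →
    T (p ≡ᵇ 2 * j) ⊎ T ((p ≡ᵇ 2 * j + 1) ∨ (p ≡ᵇ 2 * j + 2))
  outof (inj₁ e)        = inj₁ (from (T-≡ᵇ p 2j≡) e)
  outof (inj₂ (inj₁ e)) = inj₂ (from T-∨ (inj₁ (from (T-≡ᵇ p 2j+1≡) e)))
  outof (inj₂ (inj₂ e)) = inj₂ (from T-∨ (inj₂ (from (T-≡ᵇ p 2j+2≡) e)))

sharesTri⇒ : ∀ n a b → T (sharesTri n a b) →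
  ∃[ j ] (j < n × InTriangle j a × InTriangle j b)
sharesTri⇒ (suc n) a b h with to (T-∨ {inTri n a ∧ inTri n b}) h
... | inj₁ h₀ = let ha , hb = to (T-∧ {inTri n a}) h₀ in
  n , n<1+n n , to (T-inTri n a) ha , to (T-inTri n b) hb
... | inj₂ h₁ = let j , j<n , a∈j , b∈j = sharesTri⇒ n a b h₁ in
  j , m<n⇒m<1+n j<n , a∈j , b∈j

sharesTri⇐ : ∀ n a b j → j < n → InTriangle j a → InTriangle j b → T (sharesTri n a b)
sharesTri⇐ (suc n) a b j j<1+n a∈j b∈j with m<1+n⇒m<n∨m≡n j<1+n
... | inj₁ j<n  = from T-∨ (inj₂ (sharesTri⇐ n a b j j<n a∈j b∈j))
... | inj₂ refl =
  from T-∨ (inj₁ (from T-∧ (from (T-inTri j a) a∈j , from (T-inTri j b) b∈j)))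

T-adj : ∀ n (x y : Vertex n) → T (adj n x y) ⇔ Adjacent n (toℕ x) (toℕ y)
T-adj n x y = mk⇔
  (λ h → let h₀ , h₁ = to (T-∧ {not (toℕ x ≡ᵇ toℕ y)}) h in
    to (T-not-≡ᵇ (toℕ x) (toℕ y)) h₀ , sharesTri⇒ n (toℕ x) (toℕ y) h₁)
  (λ (x≢y , j , j<n , x∈j , y∈j) →
    from T-∧ (from (T-not-≡ᵇ (toℕ x) (toℕ y)) x≢y ,
              sharesTri⇐ n (toℕ x) (toℕ y) j j<n x∈j y∈j))

oneMarked : (ℕ → Bool) → ℕ → Bool
oneMarked s j = exactlyOne (s (double j)) (s (suc (double j))) (s (suc (suc (double j))))

exactlyOne-intro : ∀ a b c →
  (T a → T b → ⊥) → (T a → T c → ⊥) → (T b → T c → ⊥) →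
  (¬ T a → ¬ T b → ¬ T c → ⊥) → T (exactlyOne a b c)
exactlyOne-intro true  true  _     ab _  _  _    = ab _ _
exactlyOne-intro true  false true  _  ac _  _    = ac _ _
exactlyOne-intro true  false false _  _  _  _    = _
exactlyOne-intro false true  true  _  _  bc _    = bc _ _
exactlyOne-intro false true  false _  _  _  _    = _
exactlyOne-intro false false true  _  _  _  _    = _
exactlyOne-intro false false false _  _  _  none = none (λ ()) (λ ()) (λ ())

exactlyOne-exclusive : ∀ a b c → T (exactlyOne a b c) →
  (T a → T b → ⊥) × (T a → T c → ⊥) × (T b → T c → ⊥)
exactlyOne-exclusive true  false false _ = (λ _ ()) , (λ _ ()) , (λ ())
exactlyOne-exclusive false true  false _ = (λ ()) , (λ ()) , (λ _ ())
exactlyOne-exclusive false false true  _ = (λ ()) , (λ ()) , (λ ())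

exactlyOne-some : ∀ a b c → T (exactlyOne a b c) → T a ⊎ T b ⊎ T c
exactlyOne-some true  _     _    _ = inj₁ _
exactlyOne-some false true  _    _ = inj₂ (inj₁ _)
exactlyOne-some false false true _ = inj₂ (inj₂ _)

unique-marked-corner : ∀ s j {p q} → T (oneMarked s j) →
  InTriangle j p → InTriangle j q → T (s p) → T (s q) → p ≡ q
unique-marked-corner s j one p∈j q∈j sp sq
  with exactlyOne-exclusive (s (double j)) (s (suc (double j))) (s (suc (suc (double j)))) one
unique-marked-corner _ _ _ (inj₁ refl) (inj₁ refl) _ _ | _ = refl
unique-marked-corner _ _ _ (inj₁ refl) (inj₂ (inj₁ refl)) sp sq | ab , _ , _ = ⊥-elim (ab sp sq)
unique-marked-corner _ _ _ (inj₁ refl) (inj₂ (inj₂ refl)) sp sq | _ , ac , _ = ⊥-elim (ac sp sq)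
unique-marked-corner _ _ _ (inj₂ (inj₁ refl)) (inj₁ refl) sp sq | ab , _ , _ = ⊥-elim (ab sq sp)
unique-marked-corner _ _ _ (inj₂ (inj₁ refl)) (inj₂ (inj₁ refl)) _ _ | _ = refl
unique-marked-corner _ _ _ (inj₂ (inj₁ refl)) (inj₂ (inj₂ refl)) sp sq | _ , _ , bc = ⊥-elim (bc sp sq)
unique-marked-corner _ _ _ (inj₂ (inj₂ refl)) (inj₁ refl) sp sq | _ , ac , _ = ⊥-elim (ac sq sp)
unique-marked-corner _ _ _ (inj₂ (inj₂ refl)) (inj₂ (inj₁ refl)) sp sq | _ , _ , bc = ⊥-elim (bc sq sp)
unique-marked-corner _ _ _ (inj₂ (inj₂ refl)) (inj₂ (inj₂ refl)) _ _ | _ = refl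

some-marked-corner : ∀ s j → T (oneMarked s j) → ∃[ w ] (InTriangle j w × T (s w))
some-marked-corner s j one
  with exactlyOne-some (s (double j)) (s (suc (double j))) (s (suc (suc (double j)))) one
... | inj₁ sa        = _ , inj₁ refl , sa
... | inj₂ (inj₁ sb) = _ , inj₂ (inj₁ refl) , sb
... | inj₂ (inj₂ sc) = _ , inj₂ (inj₂ refl) , sc

Independent : ℕ → (ℕ → Bool) → Set
Independent n s = ∀ {p q} → Adjacent n p q → T (s p) → T (s q) → ⊥

insert : ℕ → (ℕ → Bool) → ℕ → Bool
insert v s p = (p ≡ᵇ v) ∨ s p

Maximal : ℕ → (ℕ → Bool) → Set
Maximal n s = ∀ v → v < suc (double n) → ¬ T (s v) → ¬ Independent n (insert v s)

OneInEachTriangle : ℕ → (ℕ → Bool) → Set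
OneInEachTriangle n s = ∀ j → j < n → T (oneMarked s j)

Independent-cong : ∀ {n s s′} → (∀ p → s p ≡ s′ p) →
  Independent n s → Independent n s′
Independent-cong s≗s′ ind p~q sp sq =
  ind p~q (subst T (sym (s≗s′ _)) sp) (subst T (sym (s≗s′ _)) sq)

T-insert : ∀ v s p → T (insert v s p) → p ≡ v ⊎ T (s p)
T-insert v s p h with to (T-∨ {p ≡ᵇ v}) h
... | inj₁ p≡v = inj₁ (≡ᵇ⇒≡ p v p≡v)
... | inj₂ sp  = inj₂ sp

insert-self : ∀ v s → T (insert v s v)
insert-self v s = from T-∨ (inj₁ (≡⇒≡ᵇ v v refl))

insert-keep : ∀ v s p → T (s p) → T (insert v s p)
insert-keep v s p sp = from (T-∨ {p ≡ᵇ v}) (inj₂ sp)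

Independent-insert : ∀ {n s v} →
  Independent n s → (∀ {q} → Adjacent n v q → ¬ T (s q)) → Independent n (insert v s)
Independent-insert {s = s} {v} ind free {p} {q} p~q@(p≢q , j , j<n , p∈j , q∈j) sp sq
  with T-insert v s p sp | T-insert v s q sq
... | inj₁ refl | inj₁ refl = p≢q refl
... | inj₁ refl | inj₂ sq′  = free p~q sq′
... | inj₂ sp′  | inj₁ refl = free (p≢q ∘ sym , j , j<n , q∈j , p∈j) sp′
... | inj₂ sp′  | inj₂ sq′  = ind p~q sp′ sq′

OneInEachTriangle⇒Independent : ∀ {n s} → OneInEachTriangle n s → Independent n s
OneInEachTriangle⇒Independent {s = s} one (p≢q , j , j<n , p∈j , q∈j) sp sq =
  p≢q (unique-marked-corner s j (one j j<n) p∈j q∈j sp sq)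

OneInEachTriangle⇒Maximal : ∀ {k s} → OneInEachTriangle (suc k) s → Maximal (suc k) s
OneInEachTriangle⇒Maximal {k} {s} one v v< ¬sv ind =
  let j , j<k , v∈j = inSomeTriangle k v v<
      w , w∈j , sw = some-marked-corner s j (one j j<k)
      v≢w = λ v≡w → ¬sv (subst (T ∘ s) (sym v≡w) sw)
  in ind (v≢w , j , j<k , v∈j , w∈j) (insert-self v s) (insert-keep v s w sw)

Independent∧Maximal⇒OneInEachTriangle : ∀ {n s} → Independent n s → Maximal n s →
  OneInEachTriangle n s
Independent∧Maximal⇒OneInEachTriangle {n} {s} ind max j j<n =
  exactlyOne-intro _ _ _
    (exclusive (1+n≢n ∘ sym) (inj₁ refl) (inj₂ (inj₁ refl)))
    (exclusive (m≢1+n+m _) (inj₁ refl) (inj₂ (inj₂ refl)))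
    (exclusive (1+n≢n ∘ sym) (inj₂ (inj₁ refl)) (inj₂ (inj₂ refl)))
    noneMarked
  where
  exclusive : ∀ {p q} → p ≢ q → InTriangle j p → InTriangle j q →
    T (s p) → T (s q) → ⊥
  exclusive p≢q p∈j q∈j = ind (p≢q , j , j<n , p∈j , q∈j)
  noneMarked :
    ¬ T (s (double j)) → ¬ T (s (suc (double j))) → ¬ T (s (suc (suc (double j)))) → ⊥
  noneMarked ¬a ¬b ¬c =
    max (suc (double j)) (1+double<1+double j<n) ¬b (Independent-insert ind free)
    where
    free : ∀ {q} → Adjacent n (suc (double j)) q → ¬ T (s q)
    free v~q with Adjacent-middle v~q
    ... | inj₁ refl = ¬a
    ... | inj₂ refl = ¬c

at : List Bool → ℕ → Bool
at []       _       = false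
at (b ∷ bs) zero    = b
at (b ∷ bs) (suc p) = at bs p

oneInEachWindow⇒ : ∀ n a w → length w ≡ double n → T (oneInEachWindow a w) →
  OneInEachTriangle n (at (a ∷ w))
oneInEachWindow⇒ (suc n) a (b ∷ c ∷ w) len h zero _ =
  proj₁ (to (T-∧ {exactlyOne a b c}) h)
oneInEachWindow⇒ (suc n) a (b ∷ c ∷ w) len h (suc j) (s≤s j<n) =
  oneInEachWindow⇒ n c w (suc-injective (suc-injective len))
    (proj₂ (to (T-∧ {exactlyOne a b c}) h)) j j<n

oneInEachWindow⇐ : ∀ n a w → length w ≡ double n → OneInEachTriangle n (at (a ∷ w)) →
  T (oneInEachWindow a w)
oneInEachWindow⇐ zero    a []          _   _   = _
oneInEachWindow⇐ (suc n) a (b ∷ c ∷ w) len one =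
  from T-∧ (one 0 z<s , oneInEachWindow⇐ n c w (suc-injective (suc-injective len)) one′)
  where
  one′ : OneInEachTriangle n (at (c ∷ w))
  one′ j j<n = one (suc j) (s≤s j<n)

lookup≡at : ∀ {m} (S : Vec Bool m) x → lookup S x ≡ at (toList S) (toℕ x)
lookup≡at (b ∷ S) Fin.zero    = refl
lookup≡at (b ∷ S) (Fin.suc x) = lookup≡at S x

at-[]≔true : ∀ {m} (S : Vec Bool m) x p →
  at (toList (S [ x ]≔ true)) p ≡ insert (toℕ x) (at (toList S)) p
at-[]≔true (b ∷ S) Fin.zero    zero    = refl
at-[]≔true (b ∷ S) Fin.zero    (suc p) = refl
at-[]≔true (b ∷ S) (Fin.suc x) zero    = refl
at-[]≔true (b ∷ S) (Fin.suc x) (suc p) = at-[]≔true S x p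

T-at-toList : ∀ {m} (S : Vec Bool m) p → T (at (toList S) p) →
  ∃[ x ] (toℕ x ≡ p × T (lookup S x))
T-at-toList (b ∷ S) zero    h = Fin.zero , refl , h
T-at-toList (b ∷ S) (suc p) h =
  let x , x≡p , sx = T-at-toList S p h in Fin.suc x , cong suc x≡p , sx

independent⇒ : ∀ n S → T (independent n S) → Independent n (at (toList S))
independent⇒ n S h {p} {q} p~q sp sq =
  let x , x≡p , sx = T-at-toList S p sp
      y , y≡q , sy = T-at-toList S q sq
      x~y = subst₂ (Adjacent n) (sym x≡p) (sym y≡q) p~q
  in to (T-not _) (to (T-all-allFin _) (to (T-all-allFin _) h x) y)
       (from T-∧ (sx , from T-∧ (sy , from (T-adj n x y) x~y)))

independent⇐ : ∀ n S → Independent n (at (toList S)) → T (independent n S)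
independent⇐ n S ind =
  from (T-all-allFin _) λ x → from (T-all-allFin _) λ y → from (T-not _) λ h →
  let sx , h′ = to (T-∧ {lookup S x}) h
      sy , x~y = to (T-∧ {lookup S y}) h′
  in ind (to (T-adj n x y) x~y) (subst T (lookup≡at S x) sx) (subst T (lookup≡at S y) sy)

T-maximalIndependent : ∀ n S →
  T (maximalIndependent n S) ⇔ (Independent n (at (toList S)) × Maximal n (at (toList S)))
T-maximalIndependent n S = mk⇔
  -- η-expanded to keep Agda from instantiating the implicit arguments of Independent.
  (λ h → let ind , max = to (T-∧ {independent n S}) h in
    (λ {p} {q} → independent⇒ n S ind {p} {q}) , maximal⇒ max)
  (λ (ind , max) → from T-∧ (independent⇐ n S ind , maximal⇐ max))
  where
  s : ℕ → Bool
  s = at (toList S)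

  nothingAddable : Bool
  nothingAddable = all (λ v → lookup S v ∨ not (independent n (S [ v ]≔ true))) (allFin _)

  maximal⇒ : T nothingAddable → Maximal n s
  maximal⇒ h v v< ¬sv ind′ = ¬sv (subst T (trans (lookup≡at S x) (cong s x≡v)) sx)
    where
    v<′ : v < suc (2 * n)
    v<′ = subst (λ m → v < suc m) (sym (2*≡double n)) v<
    x = fromℕ< v<′
    x≡v = toℕ-fromℕ< v<′
    insert≗S[x]≔true : ∀ p → insert v s p ≡ at (toList (S [ x ]≔ true)) p
    insert≗S[x]≔true p = sym (trans (at-[]≔true S x p) (cong (λ u → insert u s p) x≡v))
    sx : T (lookup S x)
    sx = to (T-∨-not (lookup S x) _) (to (T-all-allFin _) h x)
           (independent⇐ n (S [ x ]≔ true) (Independent-cong insert≗S[x]≔true ind′))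

  maximal⇐ : Maximal n s → T nothingAddable
  maximal⇐ max = from (T-all-allFin _) λ x → from (T-∨-not (lookup S x) _) λ indT →
    decidable-stable (T? (lookup S x)) λ ¬sx →
      max (toℕ x) (subst (λ m → toℕ x < suc m) (2*≡double n) (toℕ<n x))
        (¬sx ∘ subst T (sym (lookup≡at S x)))
        (Independent-cong (at-[]≔true S x) (independent⇒ n (S [ x ]≔ true) indT))

maximalIndependent≡oneInEachWindow : ∀ k a (S : Subset (2 * suc k)) →
  maximalIndependent (suc k) (a ∷ S) ≡ oneInEachWindow a (toList S)
maximalIndependent≡oneInEachWindow k a S = T-injective (mk⇔
  (λ h → let ind , max = to (T-maximalIndependent (suc k) (a ∷ S)) h in
    oneInEachWindow⇐ (suc k) a (toList S) len (Independent∧Maximal⇒OneInEachTriangle ind max))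
  (λ h → let one = oneInEachWindow⇒ (suc k) a (toList S) len h in
    from (T-maximalIndependent (suc k) (a ∷ S))
      ((λ {p} {q} → OneInEachTriangle⇒Independent one {p} {q}) ,
       OneInEachTriangle⇒Maximal one)))
  where
  len : length (toList S) ≡ double (suc k)
  len = trans (length-toList S) (2*≡double (suc k))

t-suc : ∀ k → t (suc k) ≡ windowWords false (2 * suc (suc k))
t-suc k = begin
  t (suc k)
    ≡⟨ countTrue-allSubsets-suc m (maximalIndependent (suc k)) ⟩
  countTrue (maximalIndependent (suc k) ∘ (false ∷_)) (allSubsets m) +
  countTrue (maximalIndependent (suc k) ∘ (true ∷_)) (allSubsets m)
    ≡⟨ cong₂ _+_ (countTrue-cong (maximalIndependent≡oneInEachWindow k false) (allSubsets m))
                 (countTrue-cong (maximalIndependent≡oneInEachWindow k true) (allSubsets m)) ⟩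
  windowWords false m + windowWords true m
    ≡⟨ windowWords-false m ⟨
  windowWords false (2 + m)
    ≡⟨ cong (windowWords false) (*-suc 2 (suc k)) ⟨
  windowWords false (2 * suc (suc k)) ∎
  where
  open ≡-Reasoning
  m = 2 * suc k

theorem2p2 : (t 1 ≡ 3) × (t 2 ≡ 5) ×
    ((n : ℕ) → n ≥ 3 → t n ≡ t (n ∸ 1) + t (n ∸ 2))
theorem2p2 = refl , refl , recurrence
  where
  recurrence : (n : ℕ) → n ≥ 3 → t n ≡ t (n ∸ 1) + t (n ∸ 2)
  recurrence 0 ()
  recurrence 1 (s≤s ())
  recurrence 2 (s≤s (s≤s ()))
  recurrence (suc (suc (suc m))) _ = begin
    t (3 + m)
      ≡⟨ t-suc (2 + m) ⟩
    windowWords false (2 * (4 + m))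
      ≡⟨ windowWords-fibonacci (2 + m) ⟩
    windowWords false (2 * (3 + m)) + windowWords false (2 * (2 + m))
      ≡⟨ cong₂ _+_ (t-suc (1 + m)) (t-suc m) ⟨
    t (2 + m) + t (1 + m) ∎
    where open ≡-Reasoning
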